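{- Let $G$ be a graph and let $X,Y$ be disjoint vertex sets of $G$ such that $|N(x)\cap Y|\le1$ for every $x\in X$. Then $\mathrm{tw}(G)\le\max(|N[X]\setminus Y|,\ \mathrm{tw}(G/X))$.
   Context: $\mathrm{tw}$ denotes tree-width. $N(x)$ is the neighborhood of the vertex $x$. $N(X)=\bigcup_{v\in X}N(v)\setminus X$, and $N[X]=N(X)\cup X$. $G/X$ is the graph obtained from $G$ by deleting $X$ and adding edges so that $N(X)$ becomes a clique. -}

module Defs where

open import Data.Nat using (ℕ; zero; suc; _≤_)
open import Data.Fin using (Fin; zero; suc; toℕ; _≟_)
open import Data.Fin.Subset using (Subset; _∈_; _∪_; _─_; ⋃; ∣_∣; _⊆_) renaming (⊥ to ∅)
open import Data.Vec using (lookup; tabulate)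
import Data.List as List
open import Data.Bool using (Bool; true; false; _∧_; _∨_; not; if_then_else_)
open import Data.Product using (Σ; _×_; ∃)
open import Data.Sum using (_⊎_)
open import Relation.Nullary.Decidable using (⌊_⌋)
open import Relation.Binary.PropositionalEquality using (_≡_)

-- Vertices are the elements of the subset V of
-- Fin n; E is an edge indicator which is symmetrised, restricted to V
-- and made loop-free by 'adjB' (so every record is a finite simple
-- graph and every finite simple graph arises this way).

record Graph (n : ℕ) : Set where
  field
    V : Subset n
    E : Fin n → Fin n → Bool
open Graph public

adjB : ∀ {n} → Graph n → Fin n → Fin n → Bool
adjB G u v = lookup (V G) u ∧ lookup (V G) v ∧ not ⌊ u ≟ v ⌋ ∧ (E G u v ∨ E G v u)

Adj : ∀ {n} → Graph n → Fin n → Fin n → Set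
Adj G u v = adjB G u v ≡ true

N : ∀ {n} → Graph n → Fin n → Subset n
N G x = tabulate (adjB G x)

NS : ∀ {n} → Graph n → Subset n → Subset n
NS {n} G X = ⋃ (List.tabulate (λ v → if lookup X v then N G v else ∅)) ─ X

NS[_] : ∀ {n} → Graph n → Subset n → Subset n
NS[ G ] X = NS G X ∪ X

-- G / X : delete X and make N(X) a clique.
contract : ∀ {n} → Graph n → Subset n → Graph n
contract G X = record
  { V = V G ─ X
  ; E = λ u v → E G u v ∨ (lookup (NS G X) u ∧ lookup (NS G X) v)
  }

-- A (nonempty, finite) tree on the nodes Fin (suc m), given by
-- parent pointers: node 'suc i' has parent 'parent i', which has a
-- smaller index; node 'zero' is the root.  Every finite nonempty tree
-- is isomorphic to one of this form (number the nodes in BFS order).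

record Tree (m : ℕ) : Set where
  field
    parent    : Fin m → Fin (suc m)
    parent-lt : ∀ i → toℕ (parent i) ≤ toℕ i
open Tree public

TAdj : ∀ {m} → Tree m → Fin (suc m) → Fin (suc m) → Set
TAdj T a b = (∃ λ i → a ≡ suc i × b ≡ parent T i)
           ⊎ (∃ λ i → b ≡ suc i × a ≡ parent T i)

data WalkIn {m : ℕ} (T : Tree m) (P : Fin (suc m) → Set)
       : Fin (suc m) → Fin (suc m) → Set where
  here : ∀ {a} → P a → WalkIn T P a a
  step : ∀ {a b c} → P a → TAdj T a b → WalkIn T P b c → WalkIn T P a c

ConnectedIn : ∀ {m} → Tree m → (Fin (suc m) → Set) → Set
ConnectedIn {m} T P = ∀ (a b : Fin (suc m)) → P a → P b → WalkIn T P a b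

record TreeDecomposition {n : ℕ} (G : Graph n) (k : ℕ) : Set where
  field
    m          : ℕ
    tree       : Tree m
    bag        : Fin (suc m) → Subset n
    bag⊆V      : ∀ t → bag t ⊆ V G
    vertex-cov : ∀ v → v ∈ V G → ∃ λ t → v ∈ bag t
    edge-cov   : ∀ u v → Adj G u v → ∃ λ t → (u ∈ bag t × v ∈ bag t)
    coherent   : ∀ v → ConnectedIn tree (λ t → v ∈ bag t)
    width≤     : ∀ t → ∣ bag t ∣ ≤ suc k

TwAtMost : ∀ {n} → Graph n → ℕ → Set
TwAtMost G k = TreeDecomposition G k

-- N(X) is a clique of G/X, so by the
-- Helly property of subtrees one bag contains all of N(X).  Hang a path of bags
-- C₀, …, Cₙ off that bag, where, ordering the vertices by index, Cⱼ consists of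
-- N(X) ∖ Y, the y ∈ N(X) ∩ Y with j ≤ y, and the x ∈ X all of whose Y-neighbours
-- are ≤ j.  Along the path vertices of X only enter and vertices of Y only leave, so
-- each vertex still occupies a subtree, and an edge xy with x ∈ X, y ∈ Y lies in C_y.
-- Finally |Cⱼ| ≤ |N[X] ∖ Y| + 1: apart from the vertex numbered j, send each vertex
-- of Cⱼ to itself, or, if it is some y ∈ Y with y > j, to an X-neighbour of y; this
-- is injective into N[X] ∖ Y because each x ∈ X has at most one Y-neighbour.

module Submission where

open import Defs
open import Data.Bool using (Bool; true; false; _∧_; _∨_; if_then_else_)
open import Data.Bool.Properties using (∨-comm; ∨-zeroʳ)
open import Data.List using (List; []; _∷_; allFin; filter)
open import Data.List.Extrema.Nat using (argmax; argmax-all; f[xs]≤f[argmax])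
open import Data.List.Membership.Propositional.Properties using (∈-allFin; ∈-filter⁺)
import Data.List.Relation.Unary.All as All
open import Data.List.Relation.Unary.All.Properties using (all-filter)
open import Data.List.Relation.Unary.Any as Any using (Any)
open import Data.List.Relation.Unary.Any.Properties using (tabulate⁺; tabulate⁻)
open import Data.Fin using (Fin; zero; suc; toℕ; _≟_; inject₁; fromℕ)
open import Data.Fin.Properties using (any?; all?; toℕ-injective; toℕ-inject₁; toℕ-fromℕ; toℕ<n)
open import Data.Fin.Subset
  using (Subset; ⋃; _∈_; _∉_; _⊆_; _∩_; _∪_; _─_; _-_; ⁅_⁆; ∣_∣; Empty; inside; outside)
  renaming (⊥ to ∅)
open import Data.Fin.Subset.Properties
  using ( nonempty?; Empty-unique; ∣⊥∣≡0; x∈⁅x⁆; ∣⁅x⁆∣≡1; x∈p∩q⁺; x∈p∪q⁺; x∈p∪q⁻; p─q⊆p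
        ; x∈p∧x∉q⇒x∈p─q; ∉⊥; ⊆-reflexive; x∈p∧x≢y⇒x∈p-y; x∈p⇒∣p-x∣<∣p∣; p⊆q⇒∣p∣≤∣q∣; _∈?_)
import Data.Nat as ℕ
open import Data.Nat using (ℕ; zero; suc; _≤_; _<_; _+_; _⊔_; z≤n; s≤s)
open import Data.Nat.Properties
  using ( ≤-refl; ≤-reflexive; ≤-antisym; ≤-trans; ≤-pred; ≤-<-trans; n≤1+n; 1+n≰n; <⇒≤
        ; m≤n⇒m<n∨m≡n; m≤n⇒m≤1+n; +-mono-≤; m≤m⊔n; m≤n⊔m; +-suc; +-comm; module ≤-Reasoning)
open import Data.Product using (∃; _×_; _,_; proj₁; proj₂)
open import Data.Sum using (_⊎_; inj₁; inj₂)
import Data.Sum as Sum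
open import Data.Vec using (_∷_; []; lookup; tabulate)
import Data.Vec as Vec
open import Data.Vec.Properties using ([]=⇒lookup; lookup⇒[]=; lookup∘tabulate)
open import Function using (_∘_)
open import Level using (Level)
open import Relation.Binary.PropositionalEquality using (_≡_; _≢_; refl; sym; trans; cong; subst)
open import Relation.Nullary using (¬_; Dec; yes; no; does; contradiction)
open import Relation.Nullary.Decidable using (dec-true; _×-dec_; _⊎-dec_; _→-dec_)
open import Relation.Unary using (Pred; Decidable)

private
  variable
    ℓ : Level
    n : ℕ

∈-tabulate⁻ : ∀ {f : Fin n → Bool} {x} → x ∈ tabulate f → f x ≡ true
∈-tabulate⁻ {f = f} {x} x∈ = trans (sym (lookup∘tabulate f x)) ([]=⇒lookup x∈)

∈-tabulate⁺ : ∀ {f : Fin n → Bool} {x} → f x ≡ true → x ∈ tabulate f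
∈-tabulate⁺ {f = f} {x} fx = lookup⇒[]= x (tabulate f) (trans (lookup∘tabulate f x) fx)

subsetOf : {P : Pred (Fin n) ℓ} → Decidable P → Subset n
subsetOf P? = tabulate (does ∘ P?)

module _ {P : Pred (Fin n) ℓ} (P? : Decidable P) {x : Fin n} where

  ∈-subsetOf⁺ : P x → x ∈ subsetOf P?
  ∈-subsetOf⁺ px = ∈-tabulate⁺ (dec-true (P? x) px)

  ∈-subsetOf⁻ : x ∈ subsetOf P? → P x
  ∈-subsetOf⁻ x∈ with P? x | ∈-tabulate⁻ {f = does ∘ P?} x∈
  ... | yes px | _ = px
  ... | no _   | ()

x∈p─q⇒x∉q : ∀ {x : Fin n} (p q : Subset n) → x ∈ p ─ q → x ∉ q
x∈p─q⇒x∉q (inside ∷ p) (outside ∷ q) Vec.here ()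
x∈p─q⇒x∉q (_ ∷ p) (_ ∷ q) (Vec.there x∈) (Vec.there x∈q) = x∈p─q⇒x∉q p q x∈ x∈q

x∈p-y⇒x≢y : ∀ {x y : Fin n} {p : Subset n} → x ∈ p - y → x ≢ y
x∈p-y⇒x≢y {y = y} {p} x∈ refl = x∈p─q⇒x∉q p ⁅ y ⁆ x∈ (x∈⁅x⁆ y)

∣p∪q∣≤∣p∣+∣q∣ : ∀ (p q : Subset n) → ∣ p ∪ q ∣ ≤ ∣ p ∣ + ∣ q ∣
∣p∪q∣≤∣p∣+∣q∣ []            []            = z≤n
∣p∪q∣≤∣p∣+∣q∣ (inside  ∷ p) (inside  ∷ q) rewrite +-suc ∣ p ∣ ∣ q ∣ = s≤s (≤-trans (∣p∪q∣≤∣p∣+∣q∣ p q) (n≤1+n _))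
∣p∪q∣≤∣p∣+∣q∣ (inside  ∷ p) (outside ∷ q) = s≤s (∣p∪q∣≤∣p∣+∣q∣ p q)
∣p∪q∣≤∣p∣+∣q∣ (outside ∷ p) (inside  ∷ q) rewrite +-suc ∣ p ∣ ∣ q ∣ = s≤s (∣p∪q∣≤∣p∣+∣q∣ p q)
∣p∪q∣≤∣p∣+∣q∣ (outside ∷ p) (outside ∷ q) = ∣p∪q∣≤∣p∣+∣q∣ p q

∣p∣≤∣p─q∣+∣q∣ : ∀ (p q : Subset n) → ∣ p ∣ ≤ ∣ p ─ q ∣ + ∣ q ∣
∣p∣≤∣p─q∣+∣q∣ p q = ≤-trans (p⊆q⇒∣p∣≤∣q∣ split) (∣p∪q∣≤∣p∣+∣q∣ (p ─ q) q)
  where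
  split : p ⊆ (p ─ q) ∪ q
  split {x} x∈p with x ∈? q
  ... | yes x∈q = x∈p∪q⁺ (inj₂ x∈q)
  ... | no  x∉q = x∈p∪q⁺ (inj₁ (x∈p∧x∉q⇒x∈p─q x∈p x∉q))

∣p∣≡0 : ∀ {p : Subset n} → Empty p → ∣ p ∣ ≡ 0
∣p∣≡0 {n} empty = trans (cong ∣_∣ (Empty-unique empty)) (∣⊥∣≡0 n)

subsingleton⇒∣p∣≤1 : ∀ {p : Subset n} → (∀ {x y} → x ∈ p → y ∈ p → x ≡ y) → ∣ p ∣ ≤ 1
subsingleton⇒∣p∣≤1 {p = p} unique with nonempty? p
... | no  empty      = ≤-trans (≤-reflexive (∣p∣≡0 empty)) z≤n
... | yes (x , x∈p) = ≤-trans (p⊆q⇒∣p∣≤∣q∣ p⊆⁅x⁆) (≤-reflexive (∣⁅x⁆∣≡1 x))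
  where
  p⊆⁅x⁆ : p ⊆ ⁅ x ⁆
  p⊆⁅x⁆ y∈p rewrite unique x∈p y∈p = x∈⁅x⁆ _

∣p∣≤1⇒subsingleton : ∀ {p : Subset n} {x y} → ∣ p ∣ ≤ 1 → x ∈ p → y ∈ p → x ≡ y
∣p∣≤1⇒subsingleton {p = p} {x} {y} ∣p∣≤1 x∈p y∈p with x ≟ y
... | yes x≡y = x≡y
... | no  x≢y = contradiction (≤-trans 2≤∣p∣ ∣p∣≤1) λ { (s≤s ()) }
  where
  2≤∣p∣ : 2 ≤ ∣ p ∣
  2≤∣p∣ = ≤-trans (s≤s (≤-trans (s≤s z≤n) (x∈p⇒∣p-x∣<∣p∣ (x∈p∧x≢y⇒x∈p-y y∈p (x≢y ∘ sym))))) (x∈p⇒∣p-x∣<∣p∣ x∈p)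

injection⇒∣p∣≤∣q∣ : ∀ {m n} {p : Subset m} {q : Subset n} (f : ∀ x → x ∈ p → Fin n)
                  → (∀ x x∈p → f x x∈p ∈ q)
                  → (∀ x y x∈p y∈p → f x x∈p ≡ f y y∈p → x ≡ y)
                  → ∣ p ∣ ≤ ∣ q ∣
injection⇒∣p∣≤∣q∣ {p = p} = bounded ∣ p ∣ ≤-refl
  where
  bounded : ∀ {m n} d {p : Subset m} {q : Subset n} → ∣ p ∣ ≤ d → (f : ∀ x → x ∈ p → Fin n)
          → (∀ x x∈p → f x x∈p ∈ q) → (∀ x y x∈p y∈p → f x x∈p ≡ f y y∈p → x ≡ y)
          → ∣ p ∣ ≤ ∣ q ∣
  bounded d {p} ∣p∣≤d f f∈q f-inj with nonempty? p
  ... | no empty = ≤-trans (≤-reflexive (∣p∣≡0 empty)) z≤n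
  bounded zero    ∣p∣≤d f f∈q f-inj | yes (a , a∈p) = contradiction (≤-trans (x∈p⇒∣p-x∣<∣p∣ a∈p) ∣p∣≤d) λ ()
  bounded (suc d) {p} {q} ∣p∣≤d f f∈q f-inj | yes (a , a∈p) = begin
    ∣ p ∣                 ≤⟨ ∣p∣≤∣p─q∣+∣q∣ p ⁅ a ⁆ ⟩
    ∣ p - a ∣ + ∣ ⁅ a ⁆ ∣  ≡⟨ trans (cong (∣ p - a ∣ +_) (∣⁅x⁆∣≡1 a)) (+-comm _ 1) ⟩
    suc ∣ p - a ∣          ≤⟨ s≤s (bounded d ∣p-a∣≤d f′ f′∈q-fa f′-inj) ⟩
    suc ∣ q - f a a∈p ∣    ≤⟨ x∈p⇒∣p-x∣<∣p∣ (f∈q a a∈p) ⟩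
    ∣ q ∣                 ∎
    where
    open ≤-Reasoning
    ∣p-a∣≤d : ∣ p - a ∣ ≤ d
    ∣p-a∣≤d = ≤-pred (≤-trans (x∈p⇒∣p-x∣<∣p∣ a∈p) ∣p∣≤d)
    f′ : ∀ x → x ∈ p - a → Fin _
    f′ x x∈ = f x (p─q⊆p p ⁅ a ⁆ x∈)
    f′∈q-fa : ∀ x x∈ → f′ x x∈ ∈ q - f a a∈p
    f′∈q-fa x x∈ = x∈p∧x≢y⇒x∈p-y (f∈q x _) (x∈p-y⇒x≢y x∈ ∘ f-inj x a _ a∈p)
    f′-inj : ∀ x y x∈ y∈ → f′ x x∈ ≡ f′ y y∈ → x ≡ y
    f′-inj x y x∈ y∈ = f-inj x y _ _

∈-⋃⁻ : ∀ {x : Fin n} (ps : List (Subset n)) → x ∈ ⋃ ps → Any (x ∈_) ps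
∈-⋃⁻ []       x∈ = contradiction x∈ ∉⊥
∈-⋃⁻ (p ∷ ps) x∈ with x∈p∪q⁻ p (⋃ ps) x∈
... | inj₁ x∈p  = Any.here x∈p
... | inj₂ x∈ps = Any.there (∈-⋃⁻ ps x∈ps)

∈-⋃⁺ : ∀ {x : Fin n} {ps : List (Subset n)} → Any (x ∈_) ps → x ∈ ⋃ ps
∈-⋃⁺ (Any.here x∈p)   = x∈p∪q⁺ (inj₁ x∈p)
∈-⋃⁺ (Any.there x∈ps) = x∈p∪q⁺ (inj₂ (∈-⋃⁺ x∈ps))

module _ (G : Graph n) {u v : Fin n} where

  Adj⁺ : u ∈ V G → v ∈ V G → u ≢ v → (E G u v ∨ E G v u) ≡ true → Adj G u v
  Adj⁺ u∈V v∈V u≢v uv∈E rewrite []=⇒lookup u∈V | []=⇒lookup v∈V with u ≟ v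
  ... | yes u≡v = contradiction u≡v u≢v
  ... | no  _   = uv∈E

  Adj⁻ : Adj G u v → u ∈ V G × v ∈ V G × u ≢ v × (E G u v ∨ E G v u) ≡ true
  Adj⁻ uv with lookup (V G) u in u∈V | lookup (V G) v in v∈V | u ≟ v
  ... | true | true | no u≢v = lookup⇒[]= u (V G) u∈V , lookup⇒[]= v (V G) v∈V , u≢v , uv

Adj-sym : ∀ (G : Graph n) {u v} → Adj G u v → Adj G v u
Adj-sym G {u} {v} uv with Adj⁻ G uv
... | u∈V , v∈V , u≢v , uv∈E = Adj⁺ G v∈V u∈V (u≢v ∘ sym) (trans (∨-comm (E G v u) (E G u v)) uv∈E)

module _ (G : Graph n) (X : Subset n) {w : Fin n} where

  ∈-NS⁻ : w ∈ NS G X → w ∉ X × ∃ λ x → x ∈ X × Adj G x w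
  ∈-NS⁻ w∈ = x∈p─q⇒x∉q _ X w∈ , neighbour (tabulate⁻ (∈-⋃⁻ _ (p─q⊆p _ X w∈)))
    where
    neighbour : (∃ λ x → w ∈ (if lookup X x then N G x else ∅)) → ∃ λ x → x ∈ X × Adj G x w
    neighbour (x , w∈Nx) with lookup X x in x∈X
    ... | true  = x , lookup⇒[]= x X x∈X , ∈-tabulate⁻ w∈Nx
    ... | false = contradiction w∈Nx ∉⊥

  ∈-NS⁺ : ∀ {x} → x ∈ X → Adj G x w → w ∉ X → w ∈ NS G X
  ∈-NS⁺ {x} x∈X xw w∉X = x∈p∧x∉q⇒x∈p─q (∈-⋃⁺ (tabulate⁺ x w∈Nx)) w∉X
    where
    w∈Nx : w ∈ (if lookup X x then N G x else ∅)
    w∈Nx rewrite []=⇒lookup x∈X = ∈-tabulate⁺ xw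

  NS⊆V : w ∈ NS G X → w ∈ V G
  NS⊆V w∈ with ∈-NS⁻ w∈
  ... | _ , _ , _ , xw = proj₁ (proj₂ (Adj⁻ G xw))

module _ (G : Graph n) (X : Subset n) where

  ∈-V-contract⁺ : ∀ {w} → w ∈ V G → w ∉ X → w ∈ V (contract G X)
  ∈-V-contract⁺ = x∈p∧x∉q⇒x∈p─q

  ∈-V-contract⁻ : ∀ {w} → w ∈ V (contract G X) → w ∈ V G × w ∉ X
  ∈-V-contract⁻ w∈ = p─q⊆p (V G) X w∈ , x∈p─q⇒x∉q (V G) X w∈

  Adj-contract : ∀ {u v} → Adj G u v → u ∉ X → v ∉ X → Adj (contract G X) u v
  Adj-contract {u} {v} uv u∉X v∉X with Adj⁻ G uv
  ... | u∈V , v∈V , u≢v , uv∈E =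
    Adj⁺ (contract G X) (∈-V-contract⁺ u∈V u∉X) (∈-V-contract⁺ v∈V v∉X) u≢v (widen (E G u v) (E G v u) uv∈E)
    where
    widen : ∀ a b {c d} → (a ∨ b) ≡ true → ((a ∨ c) ∨ (b ∨ d)) ≡ true
    widen true  _        _ = refl
    widen false true {c} _ = ∨-zeroʳ c

  NS-clique : ∀ {u v} → u ∈ NS G X → v ∈ NS G X → u ≢ v → Adj (contract G X) u v
  NS-clique {u} {v} u∈ v∈ u≢v =
    Adj⁺ (contract G X) (∈-V-contract⁺ (NS⊆V G X u∈) (proj₁ (∈-NS⁻ G X u∈)))
         (∈-V-contract⁺ (NS⊆V G X v∈) (proj₁ (∈-NS⁻ G X v∈))) u≢v
         uv∈E
    where
    uv∈E : ((E G u v ∨ (lookup (NS G X) u ∧ lookup (NS G X) v)) ∨ (E G v u ∨ (lookup (NS G X) v ∧ lookup (NS G X) u))) ≡ true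
    uv∈E rewrite []=⇒lookup u∈ | []=⇒lookup v∈ | ∨-zeroʳ (E G u v) = refl

∃-maximal : ∀ {P : Pred (Fin n) ℓ} → Decidable P → (f : Fin n → ℕ) → ∃ P
          → ∃ λ v → P v × ∀ x → P x → f x ≤ f v
∃-maximal {n = n} P? f (w , pw) =
  v , argmax-all f pw (all-filter P? (allFin n)) ,
  λ x px → All.lookup (f[xs]≤f[argmax] w candidates) (∈-filter⁺ P? (∈-allFin x) px)
  where
  candidates : List (Fin n)
  candidates = filter P? (allFin n)
  v : Fin n
  v = argmax f w candidates

-- Subtrees of a rooted tree and the Helly property

module Ancestry {m : ℕ} (T : Tree m) where

  Node : Set
  Node = Fin (suc m)

  infix 4 _⊑_
  data _⊑_ (s : Node) : Node → Set where
    ⊑-refl   : s ⊑ s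
    ⊑-parent : ∀ i → s ⊑ parent T i → s ⊑ suc i

  node-rec : ∀ (P : Node → Set ℓ) → P zero → (∀ i → P (parent T i) → P (suc i)) → ∀ a → P a
  node-rec P base child a = go (suc (toℕ a)) a ≤-refl
    where
    go : ∀ k a → toℕ a < k → P a
    go (suc k) zero    _          = base
    go (suc k) (suc i) (s≤s i<k) = child i (go k (parent T i) (≤-<-trans (parent-lt T i) i<k))

  ⊑⇒≤ : ∀ {s a} → s ⊑ a → toℕ s ≤ toℕ a
  ⊑⇒≤ ⊑-refl         = ≤-refl
  ⊑⇒≤ (⊑-parent i s⊑) = ≤-trans (⊑⇒≤ s⊑) (≤-trans (parent-lt T i) (n≤1+n _))

  suc⋢parent : ∀ i → ¬ (suc i ⊑ parent T i)
  suc⋢parent i si⊑ = 1+n≰n (≤-trans (⊑⇒≤ si⊑) (parent-lt T i))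

  ⊑-trans : ∀ {a b c} → a ⊑ b → b ⊑ c → a ⊑ c
  ⊑-trans a⊑b ⊑-refl          = a⊑b
  ⊑-trans a⊑b (⊑-parent i b⊑) = ⊑-parent i (⊑-trans a⊑b b⊑)

  ⊑-comparable : ∀ {a b s} → a ⊑ s → b ⊑ s → a ⊑ b ⊎ b ⊑ a
  ⊑-comparable ⊑-refl          b⊑s               = inj₂ b⊑s
  ⊑-comparable (⊑-parent i a⊑) ⊑-refl            = inj₁ (⊑-parent i a⊑)
  ⊑-comparable (⊑-parent i a⊑) (⊑-parent .i b⊑) = ⊑-comparable a⊑ b⊑

  root⊑ : ∀ a → zero ⊑ a
  root⊑ = node-rec (zero ⊑_) ⊑-refl ⊑-parent

  _⊑?_ : ∀ s a → Dec (s ⊑ a)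
  s ⊑? a = node-rec (λ a → Dec (s ⊑ a)) (decide-root s) decide-child a
    where
    decide-root : ∀ s → Dec (s ⊑ zero)
    decide-root zero    = yes ⊑-refl
    decide-root (suc i) = no λ ()
    decide-child : ∀ i → Dec (s ⊑ parent T i) → Dec (s ⊑ suc i)
    decide-child i s⊑p? with s ≟ suc i | s⊑p?
    ... | yes refl | _       = yes ⊑-refl
    ... | no _     | yes s⊑p = yes (⊑-parent i s⊑p)
    ... | no s≢si  | no s⋢p  = no λ { ⊑-refl → s≢si refl ; (⊑-parent .i s⊑p) → s⋢p s⊑p }

  -- P r sits under the quantifier so that the empty set has a top as well.
  IsTop : (Node → Set) → Node → Set
  IsTop P r = ∀ b → P b → P r × r ⊑ b

  module _ {P : Node → Set} where

    walk-head : ∀ {a c} → WalkIn T P a c → P a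
    walk-head (here pa)     = pa
    walk-head (step pa _ _) = pa

    walk-leaves-subtree : ∀ {j a c} → WalkIn T P a c → suc j ⊑ a → ¬ (suc j ⊑ c) → P (parent T j)
    walk-leaves-subtree (here _) j⊑a j⋢c = contradiction j⊑a j⋢c
    walk-leaves-subtree {j} (step {b = b} _ ab walk) j⊑a j⋢c with suc j ⊑? b
    ... | yes j⊑b = walk-leaves-subtree walk j⊑b j⋢c
    ... | no j⋢b = edge-leaves ab j⊑a j⋢b (walk-head walk)
      where
      edge-leaves : ∀ {a b} → TAdj T a b → suc j ⊑ a → ¬ (suc j ⊑ b) → P b → P (parent T j)
      edge-leaves (inj₁ (i , refl , refl)) ⊑-refl            _   pb = pb
      edge-leaves (inj₁ (i , refl , refl)) (⊑-parent .i j⊑b) j⋢b _  = contradiction j⊑b j⋢b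
      edge-leaves (inj₂ (i , refl , refl)) j⊑a               j⋢b _  = contradiction (⊑-parent i j⊑a) j⋢b

    module _ (connected : ConnectedIn T P) where

      leaves-subtree : ∀ {j a c} → P a → P c → suc j ⊑ a → ¬ (suc j ⊑ c) → P (parent T j)
      leaves-subtree pa pc = walk-leaves-subtree (connected _ _ pa pc)

      top : Decidable P → ∃ (IsTop P)
      top P? with any? P?
      ... | no  empty    = zero , λ b pb → contradiction (b , pb) empty
      ... | yes (a , pa) = node-rec (λ a → P a → ∃ (IsTop P)) root-top climb a pa
        where
        root-top : P zero → ∃ (IsTop P)
        root-top p₀ = zero , λ b _ → p₀ , root⊑ b
        climb : ∀ i → (P (parent T i) → ∃ (IsTop P)) → P (suc i) → ∃ (IsTop P)
        climb i ih psi with P? (parent T i)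
        ... | yes pp = ih pp
        ... | no ¬pp = suc i , λ b pb → psi , below b pb
          where
          below : ∀ b → P b → suc i ⊑ b
          below b pb with suc i ⊑? b
          ... | yes si⊑b = si⊑b
          ... | no  si⋢b = contradiction (leaves-subtree psi pb ⊑-refl si⋢b) ¬pp

      top-convex : ∀ {r x s} → IsTop P r → r ⊑ x → x ⊑ s → P s → P x
      top-convex r-top r⊑x ⊑-refl            ps = ps
      top-convex {r} r-top r⊑x (⊑-parent i x⊑) ps with suc i ⊑? r
      ... | yes si⊑r = contradiction (⊑-trans si⊑r (⊑-trans r⊑x x⊑)) (suc⋢parent i)
      ... | no  si⋢r = top-convex r-top r⊑x x⊑ (leaves-subtree ps pr ⊑-refl si⋢r)
        where pr = proj₁ (r-top _ ps)

module _ {m n} (T : Tree m) (bag : Fin (suc m) → Subset n)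
         (coherent : ∀ v → ConnectedIn T (λ t → v ∈ bag t)) where
  open Ancestry T

  topOf : Fin n → Node
  topOf u = proj₁ (top (coherent u) (λ t → u ∈? bag t))

  topOf-isTop : ∀ u → IsTop (λ t → u ∈ bag t) (topOf u)
  topOf-isTop u = proj₂ (top (coherent u) (λ t → u ∈? bag t))

  module _ (K : Subset n)
           (covered : ∀ u → u ∈ K → ∃ λ t → u ∈ bag t)
           (together : ∀ u w → u ∈ K → w ∈ K → u ≢ w → ∃ λ t → u ∈ bag t × w ∈ bag t) where

    ∈topOf : ∀ {u} → u ∈ K → u ∈ bag (topOf u)
    ∈topOf {u} u∈K = let t , u∈t = covered u u∈K in proj₁ (topOf-isTop u t u∈t)

    deepest-top⊇clique : ∀ {v} → v ∈ K → (∀ u → u ∈ K → toℕ (topOf u) ≤ toℕ (topOf v)) → K ⊆ bag (topOf v)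
    deepest-top⊇clique {v} v∈K deepest {u} u∈K with u ≟ v
    ... | yes refl = ∈topOf u∈K
    ... | no  u≢v  = shared-bag (together u v u∈K v∈K u≢v)
      where
      shared-bag : (∃ λ s → u ∈ bag s × v ∈ bag s) → u ∈ bag (topOf v)
      shared-bag (s , u∈s , v∈s) with ⊑-comparable (proj₂ (topOf-isTop v s v∈s)) (proj₂ (topOf-isTop u s u∈s))
      ... | inj₁ v⊑u = subst (λ t → u ∈ bag t) (toℕ-injective (≤-antisym (deepest u u∈K) (⊑⇒≤ v⊑u))) (∈topOf u∈K)
      ... | inj₂ u⊑v = top-convex (coherent u) (topOf-isTop u) u⊑v (proj₂ (topOf-isTop v s v∈s)) u∈s

    clique-in-bag : ∃ λ t → K ⊆ bag t
    clique-in-bag with nonempty? K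
    ... | no  empty = zero , λ u∈K → contradiction (_ , u∈K) empty
    ... | yes some  = let v , v∈K , deepest = ∃-maximal (_∈? K) (toℕ ∘ topOf) some
                      in topOf v , deepest-top⊇clique v∈K deepest

-- Attaching a path of bags

snoc : ∀ {A : Set ℓ} {k} → (Fin k → A) → A → Fin (suc k) → A
snoc {k = zero}  f a zero    = a
snoc {k = suc k} f a zero    = f zero
snoc {k = suc k} f a (suc i) = snoc (f ∘ suc) a i

snoc-inject₁ : ∀ {A : Set ℓ} {k} (f : Fin k → A) a i → snoc f a (inject₁ i) ≡ f i
snoc-inject₁ {k = suc k} f a zero    = refl
snoc-inject₁ {k = suc k} f a (suc i) = snoc-inject₁ (f ∘ suc) a i

snoc-last : ∀ {A : Set ℓ} {k} (f : Fin k → A) a → snoc f a (fromℕ k) ≡ a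
snoc-last {k = zero}  f a = refl
snoc-last {k = suc k} f a = snoc-last (f ∘ suc) a

inject₁-or-last : ∀ {k} (i : Fin (suc k)) → (∃ λ j → i ≡ inject₁ j) ⊎ i ≡ fromℕ k
inject₁-or-last {zero}  zero    = inj₂ refl
inject₁-or-last {suc k} zero    = inj₁ (zero , refl)
inject₁-or-last {suc k} (suc i) with inject₁-or-last i
... | inj₁ (j , refl) = inj₁ (suc j , refl)
... | inj₂ refl       = inj₂ refl

record BagTree (n : ℕ) : Set where
  field
    m        : ℕ
    tree     : Tree m
    bag      : Fin (suc m) → Subset n
    coherent : ∀ v → ConnectedIn tree (λ t → v ∈ bag t)

open BagTree

Absent : BagTree n → Fin n → Set
Absent D v = ∀ t → v ∉ bag D t

module AttachLeaf (D : BagTree n) (p : Fin (suc (m D))) (B : Subset n)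
                  (fresh : ∀ v → v ∈ B → v ∈ bag D p ⊎ Absent D v) where

  private
    M : ℕ
    M = m D
    T : Tree M
    T = tree D

  leaf : Fin (suc (suc M))
  leaf = fromℕ (suc M)

  tree⁺ : Tree (suc M)
  tree⁺ = record { parent = snoc (inject₁ ∘ parent T) (inject₁ p) ; parent-lt = parent-lt⁺ }
    where
    parent-lt⁺ : ∀ i → toℕ (snoc (inject₁ ∘ parent T) (inject₁ p) i) ≤ toℕ i
    parent-lt⁺ i with inject₁-or-last i
    ... | inj₁ (j , refl) rewrite snoc-inject₁ (inject₁ ∘ parent T) (inject₁ p) j
                                | toℕ-inject₁ (parent T j) | toℕ-inject₁ j = parent-lt T j
    ... | inj₂ refl rewrite snoc-last (inject₁ ∘ parent T) (inject₁ p)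
                          | toℕ-inject₁ p | toℕ-fromℕ M = ≤-pred (toℕ<n p)

  bag⁺ : Fin (suc (suc M)) → Subset n
  bag⁺ = snoc (bag D) B

  bag⁺-old : ∀ t → bag⁺ (inject₁ t) ≡ bag D t
  bag⁺-old = snoc-inject₁ (bag D) B

  bag⁺-leaf : bag⁺ leaf ≡ B
  bag⁺-leaf = snoc-last (bag D) B

  bag⁺-cases : ∀ t → (∃ λ t₀ → bag⁺ t ≡ bag D t₀) ⊎ bag⁺ t ≡ B
  bag⁺-cases t with inject₁-or-last t
  ... | inj₁ (t₀ , refl) = inj₁ (t₀ , bag⁺-old t₀)
  ... | inj₂ refl        = inj₂ bag⁺-leaf

  TAdj-inject₁ : ∀ {a b} → TAdj T a b → TAdj tree⁺ (inject₁ a) (inject₁ b)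
  TAdj-inject₁ (inj₁ (i , refl , refl)) = inj₁ (inject₁ i , refl , sym (snoc-inject₁ (inject₁ ∘ parent T) (inject₁ p) i))
  TAdj-inject₁ (inj₂ (i , refl , refl)) = inj₂ (inject₁ i , refl , sym (snoc-inject₁ (inject₁ ∘ parent T) (inject₁ p) i))

  leaf-parent : parent tree⁺ (fromℕ M) ≡ inject₁ p
  leaf-parent = snoc-last (inject₁ ∘ parent T) (inject₁ p)

  module _ (v : Fin n) where
    private
      P P⁺ : Fin _ → Set
      P  t = v ∈ bag D t
      P⁺ t = v ∈ bag⁺ t

    walk-inject₁ : ∀ {a c} → WalkIn T P a c → WalkIn tree⁺ P⁺ (inject₁ a) (inject₁ c)
    walk-inject₁ (here {a} pa)         = here (subst (v ∈_) (sym (bag⁺-old a)) pa)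
    walk-inject₁ (step {a} pa ab walk) = step (subst (v ∈_) (sym (bag⁺-old a)) pa) (TAdj-inject₁ ab) (walk-inject₁ walk)

    walk-snoc : ∀ {a b c} → WalkIn tree⁺ P⁺ a b → TAdj tree⁺ b c → P⁺ c → WalkIn tree⁺ P⁺ a c
    walk-snoc (here pa)          bc pc = step pa bc (here pc)
    walk-snoc (step pa ab walk) bc pc = step pa ab (walk-snoc walk bc pc)

    from-old : ∀ t → P⁺ (inject₁ t) → P t
    from-old t = subst (v ∈_) (bag⁺-old t)

    at-attachment : ∀ {t} → P t → P⁺ leaf → P p
    at-attachment {t} pt p-leaf with fresh v (subst (v ∈_) bag⁺-leaf p-leaf)
    ... | inj₁ v∈p   = v∈p
    ... | inj₂ absent = contradiction pt (absent t)

    coherent⁺ : ConnectedIn tree⁺ P⁺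
    coherent⁺ a b pa pb with inject₁-or-last a | inject₁-or-last b
    ... | inj₁ (a₀ , refl) | inj₁ (b₀ , refl) = walk-inject₁ (coherent D v a₀ b₀ (from-old a₀ pa) (from-old b₀ pb))
    ... | inj₁ (a₀ , refl) | inj₂ refl =
      walk-snoc (walk-inject₁ (coherent D v a₀ p (from-old a₀ pa) (at-attachment (from-old a₀ pa) pb)))
                (inj₂ (fromℕ M , refl , sym leaf-parent)) pb
    ... | inj₂ refl | inj₁ (b₀ , refl) =
      step pa (inj₁ (fromℕ M , refl , sym leaf-parent))
           (walk-inject₁ (coherent D v p b₀ (at-attachment (from-old b₀ pb) pa) (from-old b₀ pb)))
    ... | inj₂ refl | inj₂ refl = here pa

  attach-leaf : BagTree n
  attach-leaf = record { m = suc M ; tree = tree⁺ ; bag = bag⁺ ; coherent = coherent⁺ }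

record PathExtension (D : BagTree n) (B : ℕ → Subset n) (r : ℕ) : Set where
  field
    extension : BagTree n
    end       : Fin (suc (m extension))
    end-bag   : bag extension end ≡ B r
    old-bag   : ∀ t → ∃ λ t′ → bag extension t′ ≡ bag D t
    path-bag  : ∀ i → i ≤ r → ∃ λ t′ → bag extension t′ ≡ B i
    bag-cases : ∀ t′ → (∃ λ t → bag extension t′ ≡ bag D t) ⊎ (∃ λ i → i ≤ r × bag extension t′ ≡ B i)

module _ {D : BagTree n} {B : ℕ → Subset n} {r : ℕ} (E : PathExtension D B r) where
  open PathExtension E

  every-bag : (Q : Subset n → Set ℓ) → (∀ t → Q (bag D t)) → (∀ i → i ≤ r → Q (B i)) → ∀ t′ → Q (bag extension t′)
  every-bag Q Q-old Q-path t′ with bag-cases t′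
  ... | inj₁ (t , eq)       = subst Q (sym eq) (Q-old t)
  ... | inj₂ (i , i≤r , eq) = subst Q (sym eq) (Q-path i i≤r)

  old-bag-⊆ : ∀ t → ∃ λ t′ → bag D t ⊆ bag extension t′
  old-bag-⊆ t = let t′ , eq = old-bag t in t′ , ⊆-reflexive (sym eq)

  path-bag-⊆ : ∀ i → i ≤ r → ∃ λ t′ → B i ⊆ bag extension t′
  path-bag-⊆ i i≤r = let t′ , eq = path-bag i i≤r in t′ , ⊆-reflexive (sym eq)

module _ (D : BagTree n) (p : Fin (suc (m D))) (B : ℕ → Subset n)
         (fresh₀ : ∀ v → v ∈ B 0 → v ∈ bag D p ⊎ Absent D v)
         (fresh : ∀ j v → v ∈ B (suc j) → v ∉ B j → Absent D v × (∀ i → i ≤ j → v ∉ B i)) where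

  attach-path : ∀ r → PathExtension D B r
  attach-path zero = record
    { extension = attach-leaf
    ; end       = leaf
    ; end-bag   = bag⁺-leaf
    ; old-bag   = λ t → inject₁ t , bag⁺-old t
    ; path-bag  = λ { zero z≤n → leaf , bag⁺-leaf }
    ; bag-cases = λ t → Sum.map₂ (λ eq → 0 , z≤n , eq) (bag⁺-cases t)
    }
    where open AttachLeaf D p (B 0) fresh₀
  attach-path (suc r) = record
    { extension = attach-leaf
    ; end       = leaf
    ; end-bag   = bag⁺-leaf
    ; old-bag   = λ t → let t′ , eq = Prev.old-bag t in inject₁ t′ , trans (bag⁺-old t′) eq
    ; path-bag  = path-bag
    ; bag-cases = bag-cases
    }
    where
    module Prev = PathExtension (attach-path r)

    fresh′ : ∀ v → v ∈ B (suc r) → v ∈ bag Prev.extension Prev.end ⊎ Absent Prev.extension v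
    fresh′ v v∈ with v ∈? B r
    ... | yes v∈r = inj₁ (subst (v ∈_) (sym Prev.end-bag) v∈r)
    ... | no  v∉r = inj₂ absent
      where
      absent : Absent Prev.extension v
      absent t′ v∈t′ with Prev.bag-cases t′
      ... | inj₁ (t , eq)       = proj₁ (fresh r v v∈ v∉r) t (subst (v ∈_) eq v∈t′)
      ... | inj₂ (i , i≤r , eq) = proj₂ (fresh r v v∈ v∉r) i i≤r (subst (v ∈_) eq v∈t′)

    open AttachLeaf Prev.extension Prev.end (B (suc r)) fresh′

    path-bag : ∀ i → i ≤ suc r → ∃ λ t′ → bag⁺ t′ ≡ B i
    path-bag i i≤1+r with m≤n⇒m<n∨m≡n i≤1+r
    ... | inj₂ refl  = leaf , bag⁺-leaf
    ... | inj₁ i<1+r = let t′ , eq = Prev.path-bag i (≤-pred i<1+r) in inject₁ t′ , trans (bag⁺-old t′) eq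

    bag-cases : ∀ t′ → (∃ λ t → bag⁺ t′ ≡ bag D t) ⊎ (∃ λ i → i ≤ suc r × bag⁺ t′ ≡ B i)
    bag-cases t′ with bag⁺-cases t′
    ... | inj₂ eq       = inj₂ (suc r , ≤-refl , eq)
    ... | inj₁ (t , eq) with Prev.bag-cases t
    ...   | inj₁ (t₀ , eq′)     = inj₁ (t₀ , trans eq eq′)
    ...   | inj₂ (i , i≤r , eq′) = inj₂ (i , m≤n⇒m≤1+n i≤r , trans eq eq′)

-- The path of bags C₀, …, Cₙ

module Chain (G : Graph n) (X Y : Subset n) (X⊆V : X ⊆ V G) (X∩Y≡∅ : Empty (X ∩ Y))
             (few-Y : ∀ x → x ∈ X → ∣ N G x ∩ Y ∣ ≤ 1) where

  S : Subset n
  S = NS[ G ] X ─ Y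

  Settled : ℕ → Fin n → Set
  Settled j x = ∀ y → y ∈ N G x → y ∈ Y → toℕ y ≤ j

  InChain : ℕ → Fin n → Set
  InChain j w = (w ∈ S × (w ∈ X → Settled j w)) ⊎ (w ∈ NS G X × w ∈ Y × j ≤ toℕ w)

  InChain? : ∀ j → Decidable (InChain j)
  InChain? j w = (w ∈? S ×-dec (w ∈? X →-dec settled?)) ⊎-dec (w ∈? NS G X ×-dec w ∈? Y ×-dec j ℕ.≤? toℕ w)
    where settled? = all? λ y → y ∈? N G w →-dec y ∈? Y →-dec toℕ y ℕ.≤? j

  chain : ℕ → Subset n
  chain j = subsetOf (InChain? j)

  ∈chain⁺ : ∀ {j w} → InChain j w → w ∈ chain j
  ∈chain⁺ {j} = ∈-subsetOf⁺ (InChain? j)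

  ∈chain⁻ : ∀ {j w} → w ∈ chain j → InChain j w
  ∈chain⁻ {j} = ∈-subsetOf⁻ (InChain? j)

  ∉Y : ∀ {x} → x ∈ X → x ∉ Y
  ∉Y x∈X x∈Y = X∩Y≡∅ (_ , x∈p∩q⁺ (x∈X , x∈Y))

  X⊆S : ∀ {x} → x ∈ X → x ∈ S
  X⊆S x∈X = x∈p∧x∉q⇒x∈p─q (x∈p∪q⁺ (inj₂ x∈X)) (∉Y x∈X)

  S⊆V : ∀ {w} → w ∈ S → w ∈ V G
  S⊆V {w} w∈S with x∈p∪q⁻ (NS G X) X (p─q⊆p _ Y w∈S)
  ... | inj₁ w∈NS = NS⊆V G X w∈NS
  ... | inj₂ w∈X  = X⊆V w∈X

  S-X⊆NS : ∀ {w} → w ∈ S → w ∉ X → w ∈ NS G X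
  S-X⊆NS w∈S w∉X with x∈p∪q⁻ (NS G X) X (p─q⊆p _ Y w∈S)
  ... | inj₁ w∈NS = w∈NS
  ... | inj₂ w∈X  = contradiction w∈X w∉X

  unique-Y-neighbour : ∀ {x y y′} → x ∈ X → y ∈ N G x → y ∈ Y → y′ ∈ N G x → y′ ∈ Y → y ≡ y′
  unique-Y-neighbour {x} x∈X y∈N y∈Y y′∈N y′∈Y =
    ∣p∣≤1⇒subsingleton (few-Y x x∈X) (x∈p∩q⁺ (y∈N , y∈Y)) (x∈p∩q⁺ (y′∈N , y′∈Y))

  chain⊆V : ∀ {j w} → w ∈ chain j → w ∈ V G
  chain⊆V w∈ with ∈chain⁻ w∈
  ... | inj₁ (w∈S , _)    = S⊆V w∈S
  ... | inj₂ (w∈NS , _)  = NS⊆V G X w∈NS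

  chain-X⊆NS : ∀ {j w} → w ∈ chain j → w ∉ X → w ∈ NS G X
  chain-X⊆NS w∈ w∉X with ∈chain⁻ w∈
  ... | inj₁ (w∈S , _)   = S-X⊆NS w∈S w∉X
  ... | inj₂ (w∈NS , _) = w∈NS

  chain∩X-settled : ∀ {j x} → x ∈ X → x ∈ chain j → Settled j x
  chain∩X-settled x∈X x∈ with ∈chain⁻ x∈
  ... | inj₁ (_ , settled) = settled x∈X
  ... | inj₂ (x∈NS , _)    = contradiction x∈X (proj₁ (∈-NS⁻ G X x∈NS))

  chain∩X-mono : ∀ {i j x} → i ≤ j → x ∈ X → x ∈ chain i → x ∈ chain j
  chain∩X-mono i≤j x∈X x∈ = ∈chain⁺ (inj₁ (X⊆S x∈X , λ _ y y∈N y∈Y → ≤-trans (chain∩X-settled x∈X x∈ y y∈N y∈Y) i≤j))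

  chain-growth⊆X : ∀ {j w} → w ∈ chain (suc j) → w ∉ chain j → w ∈ X
  chain-growth⊆X {j} {w} w∈ w∉ with w ∈? X | ∈chain⁻ w∈
  ... | yes w∈X | _                            = w∈X
  ... | no  w∉X | inj₁ (w∈S , _)               = contradiction (∈chain⁺ (inj₁ (w∈S , λ w∈X → contradiction w∈X w∉X))) w∉
  ... | no  w∉X | inj₂ (w∈NS , w∈Y , 1+j≤w)    = contradiction (∈chain⁺ (inj₂ (w∈NS , w∈Y , <⇒≤ 1+j≤w))) w∉

  S-X⊆chain : ∀ {j w} → w ∈ S → w ∉ X → w ∈ chain j
  S-X⊆chain w∈S w∉X = ∈chain⁺ (inj₁ (w∈S , λ w∈X → contradiction w∈X w∉X))

  X⊆chain-n : ∀ {x} → x ∈ X → x ∈ chain n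
  X⊆chain-n x∈X = ∈chain⁺ (inj₁ (X⊆S x∈X , λ _ y _ _ → <⇒≤ (toℕ<n y)))

  X-Y-edge⊆chain : ∀ {x y} → x ∈ X → Adj G x y → y ∈ Y → x ∈ chain (toℕ y) × y ∈ chain (toℕ y)
  X-Y-edge⊆chain {x} {y} x∈X xy y∈Y =
    ∈chain⁺ (inj₁ (X⊆S x∈X , λ _ y′ y′∈N y′∈Y → ≤-reflexive (cong toℕ (unique-Y-neighbour x∈X y′∈N y′∈Y y∈N y∈Y)))) ,
    ∈chain⁺ (inj₂ (∈-NS⁺ G X x∈X xy (λ y∈X → ∉Y y∈X y∈Y) , y∈Y , ≤-refl))
    where y∈N = ∈-tabulate⁺ xy

  level : ℕ → Subset n
  level j = subsetOf (λ w → toℕ w ℕ.≟ j)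

  ∣level∣≤1 : ∀ j → ∣ level j ∣ ≤ 1
  ∣level∣≤1 j = subsingleton⇒∣p∣≤1 {p = level j} λ a∈ b∈ →
    toℕ-injective (trans (∈-subsetOf⁻ (λ w → toℕ w ℕ.≟ j) a∈) (sym (∈-subsetOf⁻ (λ w → toℕ w ℕ.≟ j) b∈)))

  module _ (j : ℕ) where

    representative : ∀ w → InChain j w → Fin n
    representative w (inj₁ _)           = w
    representative w (inj₂ (w∈NS , _)) = let _ , x , _ = ∈-NS⁻ G X w∈NS in x

    representative∈S : ∀ w c → representative w c ∈ S
    representative∈S w (inj₁ (w∈S , _))  = w∈S
    representative∈S w (inj₂ (w∈NS , _)) = let _ , _ , x∈X , _ = ∈-NS⁻ G X w∈NS in X⊆S x∈X

    settled≢representative : ∀ {a b} (ca : a ∈ S × (a ∈ X → Settled j a)) (cb : b ∈ NS G X × b ∈ Y × j ≤ toℕ b)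
                           → toℕ b ≢ j → a ≢ representative b (inj₂ cb)
    settled≢representative (_ , settled) (b∈NS , b∈Y , j≤b) b≢j refl =
      let _ , _ , x∈X , xb = ∈-NS⁻ G X b∈NS in b≢j (≤-antisym (settled x∈X _ (∈-tabulate⁺ xb) b∈Y) j≤b)

    representative-injective : ∀ a b (ca : InChain j a) (cb : InChain j b) → toℕ a ≢ j → toℕ b ≢ j
                             → representative a ca ≡ representative b cb → a ≡ b
    representative-injective a b (inj₁ ca) (inj₁ cb) _   _   a≡b  = a≡b
    representative-injective a b (inj₁ ca) (inj₂ cb) _   b≢j a≡xb = contradiction a≡xb (settled≢representative ca cb b≢j)
    representative-injective a b (inj₂ ca) (inj₁ cb) a≢j _   xa≡b = contradiction (sym xa≡b) (settled≢representative cb ca a≢j)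
    representative-injective a b (inj₂ (a∈NS , a∈Y , _)) (inj₂ (b∈NS , b∈Y , _)) _ _ xa≡xb =
      let _ , _ , xa∈X , xa-a = ∈-NS⁻ G X a∈NS
          _ , _ , _    , xb-b = ∈-NS⁻ G X b∈NS
      in unique-Y-neighbour xa∈X (∈-tabulate⁺ xa-a) a∈Y (∈-tabulate⁺ (subst (λ x → Adj G x b) (sym xa≡xb) xb-b)) b∈Y

  ∣chain∣≤1+∣S∣ : ∀ j → ∣ chain j ∣ ≤ suc ∣ S ∣
  ∣chain∣≤1+∣S∣ j = begin
    ∣ chain j ∣                          ≤⟨ ∣p∣≤∣p─q∣+∣q∣ (chain j) (level j) ⟩
    ∣ chain j ─ level j ∣ + ∣ level j ∣  ≤⟨ +-mono-≤ (injection⇒∣p∣≤∣q∣ f f∈S f-injective) (∣level∣≤1 j) ⟩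
    ∣ S ∣ + 1                            ≡⟨ +-comm ∣ S ∣ 1 ⟩
    suc ∣ S ∣                            ∎
    where
    open ≤-Reasoning
    in-chain : ∀ {w} → w ∈ chain j ─ level j → InChain j w
    in-chain w∈ = ∈chain⁻ (p─q⊆p _ _ w∈)
    off-level : ∀ {w} → w ∈ chain j ─ level j → toℕ w ≢ j
    off-level w∈ w≡j = x∈p─q⇒x∉q _ _ w∈ (∈-subsetOf⁺ (λ w → toℕ w ℕ.≟ j) w≡j)
    f : ∀ w → w ∈ chain j ─ level j → Fin n
    f w w∈ = representative j w (in-chain w∈)
    f∈S : ∀ w w∈ → f w w∈ ∈ S
    f∈S w w∈ = representative∈S j w (in-chain w∈)
    f-injective : ∀ a b a∈ b∈ → f a a∈ ≡ f b b∈ → a ≡ b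
    f-injective a b a∈ b∈ = representative-injective j a b (in-chain a∈) (in-chain b∈) (off-level a∈) (off-level b∈)

-- Lifting the decomposition of G/X to G

module Lifting (G : Graph n) (X Y : Subset n) (X⊆V : X ⊆ V G) (X∩Y≡∅ : Empty (X ∩ Y))
               (few-Y : ∀ x → x ∈ X → ∣ N G x ∩ Y ∣ ≤ 1) (k : ℕ) (TD : TwAtMost (contract G X) k) where

  open Chain G X Y X⊆V X∩Y≡∅ few-Y
  module TD = TreeDecomposition TD

  old : BagTree n
  old = record { m = TD.m ; tree = TD.tree ; bag = TD.bag ; coherent = TD.coherent }

  X-absent : ∀ {x} → x ∈ X → Absent old x
  X-absent x∈X t x∈t = proj₂ (∈-V-contract⁻ G X (TD.bag⊆V t x∈t)) x∈X

  NS-in-one-bag : ∃ λ t → NS G X ⊆ TD.bag t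
  NS-in-one-bag = clique-in-bag TD.tree TD.bag TD.coherent (NS G X) covered together
    where
    covered : ∀ u → u ∈ NS G X → ∃ λ t → u ∈ TD.bag t
    covered u u∈ = TD.vertex-cov u (∈-V-contract⁺ G X (NS⊆V G X u∈) (proj₁ (∈-NS⁻ G X u∈)))
    together : ∀ u w → u ∈ NS G X → w ∈ NS G X → u ≢ w → ∃ λ t → u ∈ TD.bag t × w ∈ TD.bag t
    together u w u∈ w∈ u≢w = TD.edge-cov u w (NS-clique G X u∈ w∈ u≢w)

  anchor : Fin (suc TD.m)
  anchor = proj₁ NS-in-one-bag

  chain₀-fresh : ∀ v → v ∈ chain 0 → v ∈ TD.bag anchor ⊎ Absent old v
  chain₀-fresh v v∈ with v ∈? X
  ... | yes v∈X = inj₂ (X-absent v∈X)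
  ... | no  v∉X = inj₁ (proj₂ NS-in-one-bag (chain-X⊆NS v∈ v∉X))

  chain-fresh : ∀ j v → v ∈ chain (suc j) → v ∉ chain j → Absent old v × (∀ i → i ≤ j → v ∉ chain i)
  chain-fresh j v v∈ v∉ = X-absent v∈X , λ i i≤j v∈i → v∉ (chain∩X-mono i≤j v∈X v∈i)
    where v∈X = chain-growth⊆X v∈ v∉

  extension : PathExtension old chain n
  extension = attach-path old anchor chain chain₀-fresh chain-fresh n

  open PathExtension extension using () renaming (extension to D)

  InOneBag : Fin n → Fin n → Set
  InOneBag u v = ∃ λ t → u ∈ bag D t × v ∈ bag D t

  in-old-bag : ∀ {u v} → (∃ λ t → u ∈ TD.bag t × v ∈ TD.bag t) → InOneBag u v
  in-old-bag (t , u∈ , v∈) = let t′ , ⊆t′ = old-bag-⊆ extension t in t′ , ⊆t′ u∈ , ⊆t′ v∈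

  in-chain : ∀ {u v} i → i ≤ n → u ∈ chain i → v ∈ chain i → InOneBag u v
  in-chain i i≤n u∈ v∈ = let t′ , ⊆t′ = path-bag-⊆ extension i i≤n in t′ , ⊆t′ u∈ , ⊆t′ v∈

  vertex-cov : ∀ v → v ∈ V G → ∃ λ t → v ∈ bag D t
  vertex-cov v v∈V with v ∈? X
  ... | yes v∈X = let t′ , ⊆t′ = path-bag-⊆ extension n ≤-refl in t′ , ⊆t′ (X⊆chain-n v∈X)
  ... | no  v∉X = let t , v∈t   = TD.vertex-cov v (∈-V-contract⁺ G X v∈V v∉X)
                      t′ , ⊆t′ = old-bag-⊆ extension t
                  in t′ , ⊆t′ v∈t

  X-edge-cov : ∀ {x v} → x ∈ X → v ∉ X → Adj G x v → InOneBag x v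
  X-edge-cov {x} {v} x∈X v∉X xv with v ∈? Y
  ... | yes v∈Y = let x∈ , v∈ = X-Y-edge⊆chain x∈X xv v∈Y in in-chain (toℕ v) (<⇒≤ (toℕ<n v)) x∈ v∈
  ... | no  v∉Y = in-chain n ≤-refl (X⊆chain-n x∈X) (S-X⊆chain v∈S v∉X)
    where v∈S = x∈p∧x∉q⇒x∈p─q (x∈p∪q⁺ (inj₁ (∈-NS⁺ G X x∈X xv v∉X))) v∉Y

  edge-cov : ∀ u v → Adj G u v → InOneBag u v
  edge-cov u v uv with u ∈? X | v ∈? X
  ... | yes u∈X | yes v∈X = in-chain n ≤-refl (X⊆chain-n u∈X) (X⊆chain-n v∈X)
  ... | yes u∈X | no  v∉X = X-edge-cov u∈X v∉X uv
  ... | no  u∉X | yes v∈X = let t , v∈ , u∈ = X-edge-cov v∈X u∉X (Adj-sym G uv) in t , u∈ , v∈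
  ... | no  u∉X | no  v∉X = in-old-bag (TD.edge-cov u v (Adj-contract G X uv u∉X v∉X))

  decomposition : TwAtMost G (∣ S ∣ ⊔ k)
  decomposition = record
    { m          = m D
    ; tree       = tree D
    ; bag        = bag D
    ; bag⊆V      = every-bag extension (_⊆ V G) (λ t → proj₁ ∘ ∈-V-contract⁻ G X ∘ TD.bag⊆V t) (λ _ _ → chain⊆V)
    ; vertex-cov = vertex-cov
    ; edge-cov   = edge-cov
    ; coherent   = coherent D
    ; width≤     = every-bag extension (λ B → ∣ B ∣ ≤ suc (∣ S ∣ ⊔ k))
                     (λ t → ≤-trans (TD.width≤ t) (s≤s (m≤n⊔m ∣ S ∣ k)))
                     (λ i _ → ≤-trans (∣chain∣≤1+∣S∣ i) (s≤s (m≤m⊔n ∣ S ∣ k)))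
    }

lemma3 : ∀ {n} (G : Graph n) (X Y : Subset n)
           → X ⊆ V G → Y ⊆ V G → Empty (X ∩ Y)
           → (∀ x → x ∈ X → ∣ N G x ∩ Y ∣ ≤ 1)
           → ∀ k → TwAtMost (contract G X) k
           → TwAtMost G (∣ NS[ G ] X ─ Y ∣ ⊔ k)
lemma3 G X Y X⊆V _ X∩Y≡∅ few-Y k TD = Lifting.decomposition G X Y X⊆V X∩Y≡∅ few-Y k TD
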